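{- Let $d,r,s\geq1$ and let $\mu=(\underbrace{d,\dotsc,d}_{r},\underbrace{1,\dotsc,1}_{s})$ (so $\ell=r+s-1$). Then \[ B_{\mu,d}(x,t)=x+x^s\,\frac{\bigl(1+tx^r(1+x+\cdots+x^{s-1})\bigr)^d-1}{1+x+\cdots+x^{s-1}}. \]
   Context: For a partition $\mu=(\mu_0\geq\cdots\geq\mu_\ell\geq1)$ and $d\geq1$: an anchor word of length $n$ is a word $a_1\cdots a_n$ over $\{1,\dotsc,d,\infty\}$ such that $a_i\neq\infty$ implies $a_{i+k}\geq a_i+\mu_k$ for $k=1,\dotsc,\ell$ ($\infty$ larger than every integer) and $a_{n-\ell+1}=\cdots=a_n=\infty$. A fault-free anchor word is either $(\infty)$ or a word starting with an integer, ending with $\ell$ consecutive $\infty$'s, with that final block the only occurrence of $\ell$ consecutive $\infty$'s. $B_{\mu,d}(x,t)=\sum x^{\mathrm{width}(w)}t^{\mathrm{bigtiles}(w)}$ over fault-free anchor words $w$, where width is the length and bigtiles the number of non-$\infty$ letters. -}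

module Defs where

open import Data.Nat using (ℕ; zero; suc; _+_; _∸_; _≤ᵇ_; _≡ᵇ_)
open import Data.Bool using (Bool; true; false; _∧_; _∨_; not; if_then_else_)
open import Data.Maybe using (Maybe; just; nothing)
open import Data.List using (List; []; _∷_; length; map; concatMap; take; drop; replicate; _++_; upTo)
open import Data.Integer using (ℤ; +_; _-_) renaming (_+_ to _+ℤ_; _*_ to _*ℤ_)

-- A letter: nothing = ∞, just a = the integer a.
Letter : Set
Letter = Maybe ℕ

_≥L_ : Letter → ℕ → Bool
nothing ≥L v = true
just b  ≥L v = v ≤ᵇ b

-- follow a (μ₁ ∷ … ∷ μ_ℓ) (a_{i+1} ∷ …) checks a_{i+k} ≥ a + μ_k, k = 1..ℓ
-- (positions beyond the end of the word impose nothing)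
follow : ℕ → List ℕ → List Letter → Bool
follow a []       _        = true
follow a (m ∷ ms) []       = true
follow a (m ∷ ms) (b ∷ bs) = (b ≥L (a + m)) ∧ follow a ms bs

constraints : List ℕ → List Letter → Bool
constraints ms []            = true
constraints ms (nothing ∷ w) = constraints ms w
constraints ms (just a ∷ w)  = follow a ms w ∧ constraints ms w

isInf : Letter → Bool
isInf nothing  = true
isInf (just _) = false

allInf : List Letter → Bool
allInf []      = true
allInf (a ∷ w) = isInf a ∧ allInf w

-- μ = (μ₀ ∷ μ₁ ∷ … ∷ μ_ℓ), so ℓ = length μ ∸ 1 and the tail is (μ₁,…,μ_ℓ)
ellOf : List ℕ → ℕ
ellOf μ = length μ ∸ 1

tailμ : List ℕ → List ℕ
tailμ []      = []
tailμ (_ ∷ m) = m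

endsWithInfs : ℕ → List Letter → Bool
endsWithInfs ℓ w = (ℓ ≤ᵇ length w) ∧ allInf (drop (length w ∸ ℓ) w)

isAnchor : List ℕ → List Letter → Bool
isAnchor μ w = constraints (tailμ μ) w ∧ endsWithInfs (ellOf μ) w

-- no block of ℓ consecutive ∞'s starting before position n-ℓ (0-based),
-- i.e. the final block is the only such occurrence
noEarlyBlock : ℕ → List Letter → Bool
noEarlyBlock ℓ []      = true
noEarlyBlock ℓ (a ∷ w) =
  (if ℓ ≤ᵇ length w then not (allInf (take ℓ (a ∷ w))) else true)
  ∧ noEarlyBlock ℓ w

startsWithInt : List Letter → Bool
startsWithInt (just _ ∷ _) = true
startsWithInt _            = false

isSingleInf : List Letter → Bool
isSingleInf (nothing ∷ []) = true
isSingleInf _              = false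

isFaultFree : List ℕ → List Letter → Bool
isFaultFree μ w =
  isSingleInf w ∨
  (isAnchor μ w ∧ startsWithInt w ∧ noEarlyBlock (ellOf μ) w)

letters : ℕ → List Letter
letters d = nothing ∷ map (λ k → just (suc k)) (upTo d)

words : ℕ → ℕ → List (List Letter)
words d zero    = [] ∷ []
words d (suc n) = concatMap (λ a → map (a ∷_) (words d n)) (letters d)

count : {A : Set} → (A → Bool) → List A → ℕ
count p []      = 0
count p (x ∷ xs) = if p x then suc (count p xs) else count p xs

bigtiles : List Letter → ℕ
bigtiles w = count (λ a → not (isInf a)) w

-- f i j = coefficient of x^i t^j
Ser : Set
Ser = ℕ → ℕ → ℤ

Σ≤ : ℕ → (ℕ → ℤ) → ℤ
Σ≤ zero    f = f zero
Σ≤ (suc n) f = Σ≤ n f +ℤ f (suc n)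

_⊕_ : Ser → Ser → Ser
(f ⊕ g) i j = f i j +ℤ g i j

_⊖_ : Ser → Ser → Ser
(f ⊖ g) i j = f i j - g i j

_⊛_ : Ser → Ser → Ser
(f ⊛ g) i j = Σ≤ i (λ a → Σ≤ j (λ b → f a b *ℤ g (i ∸ a) (j ∸ b)))

mono : ℕ → ℕ → Ser
mono p q i j = if (i ≡ᵇ p) ∧ (j ≡ᵇ q) then + 1 else + 0

one : Ser
one = mono 0 0

_^S_ : Ser → ℕ → Ser
f ^S zero  = one
f ^S suc n = f ⊛ (f ^S n)

geomS : ℕ → Ser
geomS zero    = λ _ _ → + 0
geomS (suc s) = geomS s ⊕ mono s 0

-- B_{μ,d}(x,t) = Σ x^width t^bigtiles over fault-free anchor words
B : List ℕ → ℕ → Ser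
B μ d n m = + count (λ w → isFaultFree μ w ∧ (bigtiles w ≡ᵇ m)) (words d n)

muDRS : ℕ → ℕ → ℕ → List ℕ
muDRS d r s = replicate r d ++ replicate s 1

{-# OPTIONS --safe #-}
-- After an integer letter a the next r − 1 letters must be ∞ (they would have to be ≥ a + d > d),
-- and a block of ℓ = r + s − 1 consecutive ∞'s may only end the word. So a fault-free word other
-- than (∞) is a strictly increasing sequence of integers, consecutive ones separated by r − 1 + k
-- ∞'s with 0 ≤ k < s, followed by exactly ℓ ∞'s. Writing [s] = 1 + x + ⋯ + x^{s−1}, the series of
-- continuations after an integer b is V_b = x^{r−1} (x^s + [s] A_b) with A_a = x t Σ_{a<b≤d} V_b.
-- Hence A_a = A_{a+1} + t x^r (x^s + [s] A_{a+1}) and A_d = 0, so [s] A_a + x^s = x^s P^{d−a} for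
-- P = 1 + t x^r [s], and B = x + A_0 gives the formula. Every product that occurs is a left
-- multiplication by an explicit polynomial, realised by shift operators, so no ring structure on
-- series is needed.
module Submission where

open import Defs
open import Data.Nat using (ℕ; _≥_)
open import Relation.Binary.PropositionalEquality using (_≡_)
open import Algebra.Bundles using (AbelianGroup)
import Algebra.Construct.Pointwise as Pointwise
import Algebra.Properties.AbelianGroup as AbelianGroupProperties
import Algebra.Properties.CommutativeSemigroup as CommutativeSemigroupProperties
open import Data.Bool using (Bool; true; false; _∧_; _∨_; not; if_then_else_; T)
import Data.Bool.Properties as Bool
open import Data.Integer using (ℤ; +_) renaming (_+_ to _+ℤ_; _-_ to _-ℤ_; _*_ to _*ℤ_)
import Data.Integer.Properties as ℤ
open import Data.List using (List; []; _∷_; _++_; length; map; concatMap; applyUpTo; upTo; replicate; take; drop)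
import Data.List.Properties as List
open import Data.List.Relation.Unary.All as All using (All; []; _∷_)
import Data.List.Relation.Unary.All.Properties as All
open import Data.Maybe using (just; nothing)
open import Data.Nat using (zero; suc; _+_; _∸_; _≤_; _<_; _≤ᵇ_; _<ᵇ_; _≡ᵇ_; _≤?_; z≤n; s≤s)
import Data.Nat.Properties as ℕ
open import Data.Product using (_×_; _,_)
open import Data.Unit using (⊤; tt)
open import Function using (_∘_)
open import Level using (0ℓ)
open import Relation.Binary.PropositionalEquality using (refl; cong; cong₂; sym; trans; subst; module ≡-Reasoning)
import Relation.Binary.Reasoning.Setoid as SetoidReasoning
open import Relation.Nullary using (yes; no)
open import Relation.Nullary.Decidable using (dec-true; dec-false)

infixr 30 x·_ t·_ x^_·_ t^_·_

serAbelianGroup : AbelianGroup 0ℓ 0ℓ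
serAbelianGroup = Pointwise.abelianGroup ℕ (Pointwise.abelianGroup ℕ ℤ.+-0-abelianGroup)

module Ser = AbelianGroup serAbelianGroup
open Ser using (_≈_)
open AbelianGroupProperties serAbelianGroup using (//-rightDividesʳ)
open CommutativeSemigroupProperties Ser.commutativeSemigroup
  using (interchange; x∙yz≈y∙xz; xy∙z≈xz∙y)
module ≈-Reasoning = SetoidReasoning Ser.setoid

𝟘 : Ser
𝟘 _ _ = + 0

≈-refl : ∀ {F} → F ≈ F
≈-refl _ _ = refl

⊕-cong : ∀ {F F′ G G′} → F ≈ F′ → G ≈ G′ → F ⊕ G ≈ F′ ⊕ G′
⊕-cong F≈F′ G≈G′ i j = cong₂ _+ℤ_ (F≈F′ i j) (G≈G′ i j)

-- `_≈_` is pointwise, so the operands of `_⊕_` cannot be inferred from an expected type: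
-- the one-sided congruences take the unchanged operand explicitly.
⊕-congˡ : ∀ F {G G′} → G ≈ G′ → F ⊕ G ≈ F ⊕ G′
⊕-congˡ F = ⊕-cong {F} ≈-refl

⊕-congʳ : ∀ G {F F′} → F ≈ F′ → F ⊕ G ≈ F′ ⊕ G
⊕-congʳ G F≈F′ = ⊕-cong F≈F′ (≈-refl {G})

⊖-congʳ : ∀ G {F F′} → F ≈ F′ → F ⊖ G ≈ F′ ⊖ G
⊖-congʳ G F≈F′ i j = cong (_-ℤ G i j) (F≈F′ i j)

x·_ : Ser → Ser
(x· F) zero    j = + 0
(x· F) (suc i) j = F i j

t·_ : Ser → Ser
(t· F) i zero    = + 0
(t· F) i (suc j) = F i j

x^_·_ : ℕ → Ser → Ser
x^ zero  · F = F
x^ suc p · F = x· x^ p · F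

t^_·_ : ℕ → Ser → Ser
t^ zero  · F = F
t^ suc q · F = t· t^ q · F

record Linear (L : Ser → Ser) : Set where
  field
    cong≈   : ∀ {F G} → F ≈ G → L F ≈ L G
    ⊕-homo  : ∀ F G → L (F ⊕ G) ≈ L F ⊕ L G
    𝟘-homo  : L 𝟘 ≈ 𝟘
    x·-comm : ∀ F → L (x· F) ≈ x· L F

x·-linear : Linear x·_
x·-linear = record
  { cong≈   = λ { F≈G zero j → refl ; F≈G (suc i) j → F≈G i j }
  ; ⊕-homo  = λ { F G zero j → refl ; F G (suc i) j → refl }
  ; 𝟘-homo  = λ { zero j → refl ; (suc i) j → refl }
  ; x·-comm = λ F i j → refl
  }

open Linear x·-linear using () renaming (cong≈ to x·-cong; ⊕-homo to x·-⊕; 𝟘-homo to x·-𝟘)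

t·-linear : Linear t·_
t·-linear = record
  { cong≈   = λ { F≈G i zero → refl ; F≈G i (suc j) → F≈G i j }
  ; ⊕-homo  = λ { F G i zero → refl ; F G i (suc j) → refl }
  ; 𝟘-homo  = λ { i zero → refl ; i (suc j) → refl }
  ; x·-comm = λ { F zero zero → refl ; F zero (suc j) → refl
                ; F (suc i) zero → refl ; F (suc i) (suc j) → refl }
  }

open Linear t·-linear using () renaming (cong≈ to t·-cong; 𝟘-homo to t·-𝟘)

∘-linear : ∀ {L M} → Linear L → Linear M → Linear (L ∘ M)
∘-linear {L} {M} L-lin M-lin = record
  { cong≈   = λ F≈G → L.cong≈ (M.cong≈ F≈G)
  ; ⊕-homo  = λ F G → Ser.trans (L.cong≈ (M.⊕-homo F G)) (L.⊕-homo (M F) (M G))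
  ; 𝟘-homo  = Ser.trans (L.cong≈ M.𝟘-homo) L.𝟘-homo
  ; x·-comm = λ F → Ser.trans (L.cong≈ (M.x·-comm F)) (L.x·-comm (M F))
  }
  where module L = Linear L-lin
        module M = Linear M-lin

x^-linear : ∀ p → Linear (x^ p ·_)
x^-linear zero    = record
  { cong≈ = λ F≈G → F≈G ; ⊕-homo = λ _ _ → ≈-refl
  ; 𝟘-homo = ≈-refl ; x·-comm = λ _ → ≈-refl }
x^-linear (suc p) = ∘-linear x·-linear (x^-linear p)

x^-cong : ∀ p {F G} → F ≈ G → x^ p · F ≈ x^ p · G
x^-cong p = Linear.cong≈ (x^-linear p)

x^-⊕ : ∀ p F G → x^ p · (F ⊕ G) ≈ x^ p · F ⊕ x^ p · G
x^-⊕ p = Linear.⊕-homo (x^-linear p)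

x^-⊖ : ∀ p F G → x^ p · (F ⊖ G) ≈ x^ p · F ⊖ x^ p · G
x^-⊖ zero    F G = ≈-refl
x^-⊖ (suc p) F G = Ser.trans (x·-cong (x^-⊖ p F G)) x·-⊖
  where
  x·-⊖ : x· (x^ p · F ⊖ x^ p · G) ≈ x^ suc p · F ⊖ x^ suc p · G
  x·-⊖ zero    j = refl
  x·-⊖ (suc i) j = refl

x^-comm : ∀ {L} → Linear L → ∀ p F → L (x^ p · F) ≈ x^ p · L F
x^-comm L-lin zero    F = ≈-refl
x^-comm L-lin (suc p) F =
  Ser.trans (Linear.x·-comm L-lin _) (x·-cong (x^-comm L-lin p F))

Σ≤-cong : ∀ n {f g : ℕ → ℤ} → (∀ a → f a ≡ g a) → Σ≤ n f ≡ Σ≤ n g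
Σ≤-cong zero    f≗g = f≗g 0
Σ≤-cong (suc n) f≗g = cong₂ _+ℤ_ (Σ≤-cong n f≗g) (f≗g (suc n))

Σ≤-zero : ∀ n {f : ℕ → ℤ} → (∀ a → f a ≡ + 0) → Σ≤ n f ≡ + 0
Σ≤-zero zero    f≗0 = f≗0 0
Σ≤-zero (suc n) f≗0 = cong₂ _+ℤ_ (Σ≤-zero n f≗0) (f≗0 (suc n))

Σ≤-+ : ∀ n (f g : ℕ → ℤ) → Σ≤ n (λ a → f a +ℤ g a) ≡ Σ≤ n f +ℤ Σ≤ n g
Σ≤-+ zero    f g = refl
Σ≤-+ (suc n) f g = trans (cong (_+ℤ (f (suc n) +ℤ g (suc n))) (Σ≤-+ n f g))
  (ℤ-interchange (Σ≤ n f) (Σ≤ n g) (f (suc n)) (g (suc n)))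
  where open CommutativeSemigroupProperties ℤ.+-commutativeSemigroup
          renaming (interchange to ℤ-interchange)

Σ≤-suc : ∀ n (f : ℕ → ℤ) → Σ≤ (suc n) f ≡ f 0 +ℤ Σ≤ n (f ∘ suc)
Σ≤-suc zero    f = refl
Σ≤-suc (suc n) f = trans (cong (_+ℤ f (suc (suc n))) (Σ≤-suc n f))
  (ℤ.+-assoc (f 0) (Σ≤ n (f ∘ suc)) (f (suc (suc n))))

⊛-congˡ : ∀ {F F′} G → F ≈ F′ → F ⊛ G ≈ F′ ⊛ G
⊛-congˡ G F≈F′ i j =
  Σ≤-cong i (λ a → Σ≤-cong j (λ b → cong (_*ℤ G (i ∸ a) (j ∸ b)) (F≈F′ a b)))

⊛-distribʳ : ∀ F F′ G → (F ⊕ F′) ⊛ G ≈ (F ⊛ G) ⊕ (F′ ⊛ G)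
⊛-distribʳ F F′ G i j = trans
  (Σ≤-cong i (λ a → trans
    (Σ≤-cong j (λ b → ℤ.*-distribʳ-+ (G (i ∸ a) (j ∸ b)) (F a b) (F′ a b)))
    (Σ≤-+ j _ _)))
  (Σ≤-+ i _ _)

x·-⊛ : ∀ F G → (x· F) ⊛ G ≈ x· (F ⊛ G)
x·-⊛ F G zero    j = Σ≤-zero j (λ _ → refl)
x·-⊛ F G (suc i) j = begin
  Σ≤ (suc i) (λ a → Σ≤ j (λ b → (x· F) a b *ℤ G (suc i ∸ a) (j ∸ b)))
    ≡⟨ Σ≤-suc i _ ⟩
  Σ≤ j (λ _ → + 0) +ℤ Σ≤ i (λ a → Σ≤ j (λ b → F a b *ℤ G (i ∸ a) (j ∸ b)))
    ≡⟨ cong (_+ℤ (F ⊛ G) i j) (Σ≤-zero j (λ _ → refl)) ⟩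
  + 0 +ℤ (F ⊛ G) i j
    ≡⟨ ℤ.+-identityˡ _ ⟩
  (F ⊛ G) i j ∎
  where open ≡-Reasoning

t·-⊛ : ∀ F G → (t· F) ⊛ G ≈ t· (F ⊛ G)
t·-⊛ F G i zero    = Σ≤-zero i (λ _ → refl)
t·-⊛ F G i (suc j) = Σ≤-cong i (λ a → trans (Σ≤-suc j _) (ℤ.+-identityˡ _))

one-⊛ : ∀ G → one ⊛ G ≈ G
one-⊛ G i j = begin
  Σ≤ i (λ a → Σ≤ j (λ b → one a b *ℤ G (i ∸ a) (j ∸ b)))
    ≡⟨ Σ≤-head i _ (λ a → Σ≤-zero j (λ _ → refl)) ⟩
  Σ≤ j (λ b → one 0 b *ℤ G i (j ∸ b))
    ≡⟨ Σ≤-head j _ (λ _ → refl) ⟩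
  + 1 *ℤ G i j
    ≡⟨ ℤ.*-identityˡ _ ⟩
  G i j ∎
  where
  open ≡-Reasoning
  Σ≤-head : ∀ n (f : ℕ → ℤ) → (∀ a → f (suc a) ≡ + 0) → Σ≤ n f ≡ f 0
  Σ≤-head zero    f tail≗0 = refl
  Σ≤-head (suc n) f tail≗0 =
    trans (trans (Σ≤-suc n f) (cong (f 0 +ℤ_) (Σ≤-zero n tail≗0))) (ℤ.+-identityʳ _)

mono-sucˡ : ∀ p q → mono (suc p) q ≈ x· mono p q
mono-sucˡ p q zero    j = refl
mono-sucˡ p q (suc i) j = refl

mono-sucʳ : ∀ q → mono 0 (suc q) ≈ t· mono 0 q
mono-sucʳ q zero    zero    = refl
mono-sucʳ q (suc i) zero    = refl
mono-sucʳ q i       (suc j) = refl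

mono-⊛ : ∀ p q G → mono p q ⊛ G ≈ x^ p · t^ q · G
mono-⊛ (suc p) q G = begin
  mono (suc p) q ⊛ G    ≈⟨ ⊛-congˡ G (mono-sucˡ p q) ⟩
  (x· mono p q) ⊛ G     ≈⟨ x·-⊛ (mono p q) G ⟩
  x· (mono p q ⊛ G)     ≈⟨ x·-cong (mono-⊛ p q G) ⟩
  x^ suc p · t^ q · G   ∎
  where open ≈-Reasoning
mono-⊛ zero (suc q) G = begin
  mono 0 (suc q) ⊛ G    ≈⟨ ⊛-congˡ G (mono-sucʳ q) ⟩
  (t· mono 0 q) ⊛ G     ≈⟨ t·-⊛ (mono 0 q) G ⟩
  t· (mono 0 q ⊛ G)     ≈⟨ t·-cong (mono-⊛ 0 q G) ⟩
  t^ suc q · G          ∎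
  where open ≈-Reasoning
mono-⊛ zero zero G = one-⊛ G

x^-⊛ : ∀ p F G → (x^ p · F) ⊛ G ≈ x^ p · (F ⊛ G)
x^-⊛ zero    F G = ≈-refl
x^-⊛ (suc p) F G =
  Ser.trans (x·-⊛ (x^ p · F) G) (x·-cong (x^-⊛ p F G))

geom : ℕ → Ser → Ser
geom zero    F = 𝟘
geom (suc s) F = geom s F ⊕ x^ s · F

geomS-⊛ : ∀ s G → geomS s ⊛ G ≈ geom s G
geomS-⊛ zero    G i j = Σ≤-zero i (λ _ → Σ≤-zero j (λ _ → refl))
geomS-⊛ (suc s) G = Ser.trans (⊛-distribʳ (geomS s) (mono s 0) G)
  (⊕-cong (geomS-⊛ s G) (mono-⊛ s 0 G))

geom-comm : ∀ {L} → Linear L → ∀ s F → L (geom s F) ≈ geom s (L F)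
geom-comm L-lin zero    F = Linear.𝟘-homo L-lin
geom-comm L-lin (suc s) F = Ser.trans (Linear.⊕-homo L-lin (geom s F) (x^ s · F))
  (⊕-cong (geom-comm L-lin s F) (x^-comm L-lin s F))

geom-cong : ∀ s {F G} → F ≈ G → geom s F ≈ geom s G
geom-cong zero    F≈G = ≈-refl
geom-cong (suc s) F≈G = ⊕-cong (geom-cong s F≈G) (x^-cong s F≈G)

geom-𝟘 : ∀ s → geom s 𝟘 ≈ 𝟘
geom-𝟘 zero    = ≈-refl
geom-𝟘 (suc s) =
  Ser.trans (⊕-cong (geom-𝟘 s) (Linear.𝟘-homo (x^-linear s))) (Ser.identityˡ 𝟘)

geom-⊕ : ∀ s F G → geom s (F ⊕ G) ≈ geom s F ⊕ geom s G
geom-⊕ zero    F G = Ser.sym (Ser.identityˡ 𝟘)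
geom-⊕ (suc s) F G = Ser.trans (⊕-cong (geom-⊕ s F G) (x^-⊕ s F G))
  (interchange (geom s F) (geom s G) (x^ s · F) (x^ s · G))

geom-suc : ∀ s F → geom (suc s) F ≈ F ⊕ x· geom s F
geom-suc zero    F = Ser.trans (Ser.identityˡ F)
  (Ser.sym (Ser.trans (⊕-congˡ F (x·-𝟘)) (Ser.identityʳ F)))
geom-suc (suc s) F = begin
  geom (suc s) F ⊕ x^ suc s · F
    ≈⟨ ⊕-congʳ (x^ suc s · F) (geom-suc s F) ⟩
  (F ⊕ x· geom s F) ⊕ x^ suc s · F
    ≈⟨ Ser.assoc F (x· geom s F) (x^ suc s · F) ⟩
  F ⊕ (x· geom s F ⊕ x^ suc s · F)
    ≈⟨ ⊕-congˡ F (Ser.sym (x·-⊕ (geom s F) (x^ s · F))) ⟩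
  F ⊕ x· geom (suc s) F ∎
  where open ≈-Reasoning

Σ< : ℕ → (ℕ → Ser) → Ser
Σ< zero    F = 𝟘
Σ< (suc n) F = F 0 ⊕ Σ< n (F ∘ suc)

Σ<-cong : ∀ n {F G : ℕ → Ser} → (∀ x → F x ≈ G x) → Σ< n F ≈ Σ< n G
Σ<-cong zero    F≈G = ≈-refl
Σ<-cong (suc n) F≈G = ⊕-cong (F≈G 0) (Σ<-cong n (F≈G ∘ suc))

Σ<-𝟘 : ∀ n → Σ< n (λ _ → 𝟘) ≈ 𝟘
Σ<-𝟘 zero    = ≈-refl
Σ<-𝟘 (suc n) = Ser.trans (⊕-congˡ 𝟘 (Σ<-𝟘 n)) (Ser.identityˡ 𝟘)

Σ<-comm : ∀ {L} → Linear L → ∀ n F → L (Σ< n F) ≈ Σ< n (L ∘ F)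
Σ<-comm L-lin zero    F = Linear.𝟘-homo L-lin
Σ<-comm {L} L-lin (suc n) F = Ser.trans (Linear.⊕-homo L-lin (F 0) (Σ< n (F ∘ suc)))
  (⊕-congˡ (L (F 0)) (Σ<-comm L-lin n (F ∘ suc)))

-- Σ over a ≤ x < n, with the guard written `a <ᵇ suc x` so that `suc a <ᵇ suc (suc x)` reduces
-- to the guard for a and x.
Σ-from : ℕ → ℕ → (ℕ → Ser) → Ser
Σ-from a n F = Σ< n (λ x → if a <ᵇ suc x then F x else 𝟘)

Σ-from-empty : ∀ {a n} F → n ≤ a → Σ-from a n F ≈ 𝟘
Σ-from-empty {n = zero}          F z≤n       = ≈-refl
Σ-from-empty {suc a} {n = suc n} F (s≤s n≤a) =
  Ser.trans (⊕-congˡ 𝟘 (Σ-from-empty (F ∘ suc) n≤a)) (Ser.identityˡ 𝟘)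

Σ-from-first : ∀ {a n} F → a < n → Σ-from a n F ≈ F a ⊕ Σ-from (suc a) n F
Σ-from-first {zero}  {suc n} F _ = ⊕-congˡ (F 0) (Ser.sym (Ser.identityˡ (Σ< n (F ∘ suc))))
Σ-from-first {suc a} {suc n} F (s≤s a<n) = begin
  𝟘 ⊕ Σ-from a n (F ∘ suc)
    ≈⟨ ⊕-congˡ 𝟘 (Σ-from-first (F ∘ suc) a<n) ⟩
  𝟘 ⊕ (F (suc a) ⊕ Σ-from (suc a) n (F ∘ suc))
    ≈⟨ x∙yz≈y∙xz 𝟘 (F (suc a)) (Σ-from (suc a) n (F ∘ suc)) ⟩
  F (suc a) ⊕ Σ-from (suc (suc a)) (suc n) F ∎
  where open ≈-Reasoning

module Recurrence (r s : ℕ) where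

  P : Ser
  P = one ⊕ (mono r 1 ⊛ geomS s)

  x^r·t· : Ser → Ser
  x^r·t· = x^ r ·_ ∘ t·_

  x^r·t·-linear : Linear x^r·t·
  x^r·t·-linear = ∘-linear (x^-linear r) t·-linear

  𝒫 : Ser → Ser
  𝒫 Q = Q ⊕ x^r·t· (geom s Q)

  𝒫-cong : ∀ {Q Q′} → Q ≈ Q′ → 𝒫 Q ≈ 𝒫 Q′
  𝒫-cong Q≈Q′ = ⊕-cong Q≈Q′
    (Linear.cong≈ x^r·t·-linear (geom-cong s Q≈Q′))

  P-⊛ : ∀ Q → P ⊛ Q ≈ 𝒫 Q
  P-⊛ Q = begin
    P ⊛ Q
      ≈⟨ ⊛-distribʳ one (mono r 1 ⊛ geomS s) Q ⟩
    (one ⊛ Q) ⊕ ((mono r 1 ⊛ geomS s) ⊛ Q)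
      ≈⟨ ⊕-cong (one-⊛ Q) (⊛-congˡ Q (mono-⊛ r 1 (geomS s))) ⟩
    Q ⊕ ((x^ r · t· geomS s) ⊛ Q)
      ≈⟨ ⊕-congˡ Q (x^-⊛ r (t· geomS s) Q) ⟩
    Q ⊕ x^ r · ((t· geomS s) ⊛ Q)
      ≈⟨ ⊕-congˡ Q (x^-cong r (t·-⊛ (geomS s) Q)) ⟩
    Q ⊕ x^r·t· (geomS s ⊛ Q)
      ≈⟨ ⊕-congˡ Q (Linear.cong≈ x^r·t·-linear (geomS-⊛ s Q)) ⟩
    𝒫 Q ∎
    where open ≈-Reasoning

  𝒫-x^ : ∀ p Q → 𝒫 (x^ p · Q) ≈ x^ p · 𝒫 Q
  𝒫-x^ p Q = begin
    x^ p · Q ⊕ x^r·t· (geom s (x^ p · Q))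
      ≈⟨ ⊕-congˡ (x^ p · Q)
           (Linear.cong≈ x^r·t·-linear (Ser.sym (geom-comm (x^-linear p) s Q))) ⟩
    x^ p · Q ⊕ x^r·t· (x^ p · geom s Q)
      ≈⟨ ⊕-congˡ (x^ p · Q) (x^-comm x^r·t·-linear p (geom s Q)) ⟩
    x^ p · Q ⊕ x^ p · x^r·t· (geom s Q)
      ≈⟨ Ser.sym (x^-⊕ p Q (x^r·t· (geom s Q))) ⟩
    x^ p · 𝒫 Q ∎
    where open ≈-Reasoning

  module _ (A : ℕ → Ser) (d : ℕ) (A-top : A d ≈ 𝟘)
    (A-step : ∀ a → a < d → A a ≈ A (suc a) ⊕ x^r·t· (x^ s · one ⊕ geom s (A (suc a))))
    where

    U : ℕ → Ser
    U a = geom s (A a) ⊕ x^ s · one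

    U-step : ∀ a → a < d → U a ≈ 𝒫 (U (suc a))
    U-step a a<d = begin
      geom s (A a) ⊕ X
        ≈⟨ ⊕-congʳ X (geom-cong s (A-step a a<d)) ⟩
      geom s (A′ ⊕ x^r·t· W) ⊕ X
        ≈⟨ ⊕-congʳ X (geom-⊕ s A′ (x^r·t· W)) ⟩
      (geom s A′ ⊕ geom s (x^r·t· W)) ⊕ X
        ≈⟨ xy∙z≈xz∙y (geom s A′) (geom s (x^r·t· W)) X ⟩
      U (suc a) ⊕ geom s (x^r·t· W)
        ≈⟨ ⊕-congˡ (U (suc a)) (Ser.sym (geom-comm x^r·t·-linear s W)) ⟩
      U (suc a) ⊕ x^r·t· (geom s W)
        ≈⟨ ⊕-congˡ (U (suc a))
             (Linear.cong≈ x^r·t·-linear (geom-cong s (Ser.comm X (geom s A′)))) ⟩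
      𝒫 (U (suc a)) ∎
      where
      open ≈-Reasoning
      X  = x^ s · one
      A′ = A (suc a)
      W  = X ⊕ geom s A′

    U≈x^s·P^ : ∀ k a → a + k ≡ d → U a ≈ x^ s · (P ^S k)
    U≈x^s·P^ zero a refl rewrite ℕ.+-identityʳ a = begin
      geom s (A a) ⊕ x^ s · one         ≈⟨ ⊕-congʳ (x^ s · one) (geom-cong s A-top) ⟩
      geom s 𝟘 ⊕ x^ s · one             ≈⟨ ⊕-congʳ (x^ s · one) (geom-𝟘 s) ⟩
      𝟘 ⊕ x^ s · one                    ≈⟨ Ser.identityˡ (x^ s · one) ⟩
      x^ s · one                        ∎
      where open ≈-Reasoning
    U≈x^s·P^ (suc k) a a+k≡d = begin
      U a
        ≈⟨ U-step a a<d ⟩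
      𝒫 (U (suc a))
        ≈⟨ 𝒫-cong (U≈x^s·P^ k (suc a) (trans (sym (ℕ.+-suc a k)) a+k≡d)) ⟩
      𝒫 (x^ s · (P ^S k))
        ≈⟨ 𝒫-x^ s (P ^S k) ⟩
      x^ s · 𝒫 (P ^S k)
        ≈⟨ x^-cong s (Ser.sym (P-⊛ (P ^S k))) ⟩
      x^ s · (P ^S suc k) ∎
      where
      open ≈-Reasoning
      a<d : a < d
      a<d = subst (a <_) a+k≡d (ℕ.m<m+n a (s≤s z≤n))

    closed-form : ∀ {B′} → B′ ≈ x· one ⊕ A 0 →
      geomS s ⊛ B′ ≈ (geomS s ⊛ mono 1 0) ⊕ (mono s 0 ⊛ ((P ^S d) ⊖ one))
    closed-form {B′} B′≈ = begin
      geomS s ⊛ B′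
        ≈⟨ geomS-⊛ s B′ ⟩
      geom s B′
        ≈⟨ geom-cong s B′≈ ⟩
      geom s (x· one ⊕ A 0)
        ≈⟨ geom-⊕ s (x· one) (A 0) ⟩
      geom s (x· one) ⊕ geom s (A 0)
        ≈⟨ ⊕-cong x-part (Ser.sym (//-rightDividesʳ X (geom s (A 0)))) ⟩
      (geomS s ⊛ mono 1 0) ⊕ (U 0 ⊖ X)
        ≈⟨ ⊕-congˡ (geomS s ⊛ mono 1 0) (⊖-congʳ X (U≈x^s·P^ d 0 refl)) ⟩
      (geomS s ⊛ mono 1 0) ⊕ (x^ s · (P ^S d) ⊖ X)
        ≈⟨ ⊕-congˡ (geomS s ⊛ mono 1 0) (Ser.sym (x^-⊖ s (P ^S d) one)) ⟩
      (geomS s ⊛ mono 1 0) ⊕ x^ s · ((P ^S d) ⊖ one)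
        ≈⟨ ⊕-congˡ (geomS s ⊛ mono 1 0) (Ser.sym (mono-⊛ s 0 ((P ^S d) ⊖ one))) ⟩
      (geomS s ⊛ mono 1 0) ⊕ (mono s 0 ⊛ ((P ^S d) ⊖ one)) ∎
      where
      open ≈-Reasoning
      X = x^ s · one
      x-part : geom s (x· one) ≈ geomS s ⊛ mono 1 0
      x-part = Ser.sym (Ser.trans (geomS-⊛ s (mono 1 0)) (geom-cong s (mono-sucˡ 0 0)))

count-++ : ∀ {A : Set} (p : A → Bool) xs ys →
  count p (xs ++ ys) ≡ count p xs + count p ys
count-++ p []       ys = refl
count-++ p (x ∷ xs) ys with p x
... | true  = cong suc (count-++ p xs ys)
... | false = count-++ p xs ys

count-map : ∀ {A B : Set} (p : B → Bool) (f : A → B) xs →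
  count p (map f xs) ≡ count (p ∘ f) xs
count-map p f []       = refl
count-map p f (x ∷ xs) with p (f x)
... | true  = cong suc (count-map p f xs)
... | false = count-map p f xs

count-cong : ∀ {A : Set} {p q : A → Bool} {xs} →
  All (λ x → p x ≡ q x) xs → count p xs ≡ count q xs
count-cong []                    = refl
count-cong {p = p} {q} {x ∷ xs} (px≡qx ∷ eqs) rewrite px≡qx with q x
... | true  = cong suc (count-cong eqs)
... | false = count-cong eqs

count-false : ∀ {A : Set} (p : A → Bool) xs → (∀ x → p x ≡ false) → count p xs ≡ 0
count-false p []       p≗false = refl
count-false p (x ∷ xs) p≗false rewrite p≗false x = count-false p xs p≗false

+count-concatMap : ∀ {A B : Set} (p : B → Bool) (f : A → List B) (g : ℕ → A) k (F : ℕ → Ser) {i j} →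
  (∀ x → + count p (f (g x)) ≡ F x i j) →
  + count p (concatMap f (applyUpTo g k)) ≡ Σ< k F i j
+count-concatMap p f g zero    F eq = refl
+count-concatMap p f g (suc k) F {i} {j} eq = begin
  + count p (f (g 0) ++ rest)
    ≡⟨ cong +_ (count-++ p (f (g 0)) rest) ⟩
  + (count p (f (g 0)) + count p rest)
    ≡⟨ ℤ.pos-+ (count p (f (g 0))) (count p rest) ⟩
  + count p (f (g 0)) +ℤ + count p rest
    ≡⟨ cong₂ _+ℤ_ (eq 0) (+count-concatMap p f (g ∘ suc) k (F ∘ suc) (eq ∘ suc)) ⟩
  Σ< (suc k) F i j ∎
  where
  open ≡-Reasoning
  rest = concatMap f (applyUpTo (g ∘ suc) k)

module Words (d : ℕ) where

  gf : (List Letter → Bool) → Ser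
  gf p n m = + count (λ w → p w ∧ (bigtiles w ≡ᵇ m)) (words d n)

  gf-cons : ∀ p → gf p ≈ (if p [] then one else 𝟘) ⊕
    x· (gf (λ w → p (nothing ∷ w)) ⊕ t· Σ< d (λ x → gf (λ w → p (just (suc x) ∷ w))))
  gf-cons p zero m with p []
  gf-cons p zero zero    | true  = refl
  gf-cons p zero (suc m) | true  = refl
  gf-cons p zero m       | false = refl
  gf-cons p (suc n) m = begin
    + count q (map (nothing ∷_) ws ++ concatMap f integers)
      ≡⟨ cong +_ (count-++ q (map (nothing ∷_) ws) (concatMap f integers)) ⟩
    + (count q (map (nothing ∷_) ws) + count q (concatMap f integers))
      ≡⟨ ℤ.pos-+ (count q (map (nothing ∷_) ws)) (count q (concatMap f integers)) ⟩
    + count q (map (nothing ∷_) ws) +ℤ + count q (concatMap f integers)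
      ≡⟨ cong₂ _+ℤ_ (cong +_ (count-map q (nothing ∷_) ws)) integer-letters ⟩
    gf p∞ n m +ℤ Σ< d (λ x → t· gf (pₓ x)) n m
      ≡⟨ cong (gf p∞ n m +ℤ_) (sym (Σ<-comm t·-linear d (gf ∘ pₓ) n m)) ⟩
    gf p∞ n m +ℤ (t· Σ< d (gf ∘ pₓ)) n m
      ≡⟨ sym (trans (cong (_+ℤ tails) (no-constant (p []))) (ℤ.+-identityˡ tails)) ⟩
    ((if p [] then one else 𝟘) ⊕ x· (gf p∞ ⊕ t· Σ< d (gf ∘ pₓ))) (suc n) m ∎
    where
    open ≡-Reasoning
    ws       = words d n
    integers = map (just ∘ suc) (upTo d)
    q        = λ w → p w ∧ (bigtiles w ≡ᵇ m)
    f        = λ a → map (a ∷_) ws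
    p∞       = λ w → p (nothing ∷ w)
    pₓ       = λ x w → p (just (suc x) ∷ w)
    tails    = gf p∞ n m +ℤ (t· Σ< d (gf ∘ pₓ)) n m
    no-constant : ∀ b → (if b then one else 𝟘) (suc n) m ≡ + 0
    no-constant true  = refl
    no-constant false = refl
    integer-letter : ∀ m x →
      + count (λ w → p w ∧ (bigtiles w ≡ᵇ m)) (map (just (suc x) ∷_) ws) ≡ (t· gf (pₓ x)) n m
    integer-letter zero    x =
      cong +_ (trans (count-map _ _ ws) (count-false _ ws (λ w → Bool.∧-zeroʳ (pₓ x w))))
    integer-letter (suc m) x = cong +_ (count-map _ _ ws)
    integer-letters : + count q (concatMap f integers) ≡ Σ< d (λ x → t· gf (pₓ x)) n m
    integer-letters rewrite List.map-upTo (just ∘ suc) d =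
      +count-concatMap q f (just ∘ suc) d (λ x → t· gf (pₓ x)) (integer-letter m)

  InRange : Letter → Set
  InRange nothing  = ⊤
  InRange (just b) = 1 ≤ b × b ≤ d

  words-inRange : ∀ n → All (All InRange) (words d n)
  words-inRange zero    = [] ∷ []
  words-inRange (suc n) =
    All.concat⁺ (All.map⁺ (All.map (λ ok → All.map⁺ (All.map (ok ∷_) (words-inRange n)))
                                   letters-inRange))
    where
    letters-inRange : All InRange (letters d)
    letters-inRange = tt ∷ subst (All InRange) (sym (List.map-upTo (just ∘ suc) d))
      (All.applyUpTo⁺₁ (just ∘ suc) d (λ i<d → s≤s z≤n , i<d))

  gf-cong : ∀ {p q} → (∀ {w} → All InRange w → p w ≡ q w) → gf p ≈ gf q
  gf-cong p≗q n m =
    cong +_ (count-cong (All.map (λ ok → cong (_∧ _) (p≗q ok)) (words-inRange n)))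

  gf-vanish : ∀ p → (∀ w → p w ≡ false) → gf p ≈ 𝟘
  gf-vanish p p≗false n m =
    cong +_ (count-false _ (words d n) (λ w → cong (_∧ _) (p≗false w)))

  gf-∧ : ∀ b p → gf (λ w → b ∧ p w) ≈ (if b then gf p else 𝟘)
  gf-∧ true  p = ≈-refl
  gf-∧ false p = gf-vanish (λ _ → false) (λ _ → refl)

  t·Σ<-gf-vanish : ∀ (p : ℕ → List Letter → Bool) → (∀ x w → p x w ≡ false) →
    t· Σ< d (gf ∘ p) ≈ 𝟘
  t·Σ<-gf-vanish p p≗false = Ser.trans
    (t·-cong (Ser.trans (Σ<-cong d (λ x → gf-vanish (p x) (p≗false x))) (Σ<-𝟘 d)))
    t·-𝟘

  gf-empty : ∀ p → (∀ x w → p (x ∷ w) ≡ false) → gf p ≈ (if p [] then one else 𝟘)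
  gf-empty p p≗false = begin
    gf p
      ≈⟨ gf-cons p ⟩
    C ⊕ x· (gf (λ w → p (nothing ∷ w)) ⊕ t· Σ< d (λ x → gf (λ w → p (just (suc x) ∷ w))))
      ≈⟨ ⊕-congˡ C (x·-cong (⊕-cong (gf-vanish _ (p≗false nothing))
                                    (t·Σ<-gf-vanish _ (p≗false ∘ just ∘ suc)))) ⟩
    C ⊕ x· (𝟘 ⊕ 𝟘)
      ≈⟨ ⊕-congˡ C x·-𝟘 ⟩
    C ⊕ 𝟘
      ≈⟨ Ser.identityʳ C ⟩
    C ∎
    where
    open ≈-Reasoning
    C = if p [] then one else 𝟘

≤ᵇ-true : ∀ {m n} → m ≤ n → (m ≤ᵇ n) ≡ true
≤ᵇ-true {m} {n} = dec-true (m ≤? n)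

≤ᵇ-false : ∀ {m n} → n < m → (m ≤ᵇ n) ≡ false
≤ᵇ-false {m} {n} n<m = dec-false (m ≤? n) (ℕ.<⇒≱ n<m)

≤ᵇ≡true⇒≤ : ∀ {m n} → (m ≤ᵇ n) ≡ true → m ≤ n
≤ᵇ≡true⇒≤ {m} {n} eq = ℕ.≤ᵇ⇒≤ m n (subst T (sym eq) tt)

finalBlockOnly : ℕ → List Letter → Bool
finalBlockOnly ℓ v = endsWithInfs ℓ v ∧ noEarlyBlock ℓ v

length-infs : ∀ c (w : List Letter) → length (replicate c nothing ++ w) ≡ c + length w
length-infs c w =
  trans (List.length-++ (replicate c nothing)) (cong (_+ length w) (List.length-replicate c))

infs-snoc : ∀ c (w : List Letter) →
  replicate c nothing ++ nothing ∷ w ≡ nothing ∷ replicate c nothing ++ w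
infs-snoc zero    w = refl
infs-snoc (suc c) w = cong (nothing ∷_) (infs-snoc c w)

allInf-replicate : ∀ n → allInf (replicate n nothing) ≡ true
allInf-replicate zero    = refl
allInf-replicate (suc n) = allInf-replicate n

allInf-take-infs : ∀ n v → allInf (take n (replicate n nothing ++ v)) ≡ true
allInf-take-infs zero    v = refl
allInf-take-infs (suc n) v = allInf-take-infs n v

allInf-take-just : ∀ c k b w → c < k →
  allInf (take k (replicate c nothing ++ just b ∷ w)) ≡ false
allInf-take-just zero    (suc k) b w _         = refl
allInf-take-just (suc c) (suc k) b w (s≤s c<k) = allInf-take-just c k b w c<k

allInf-drop-just : ∀ u k b w → k ≤ length u → allInf (drop k (u ++ just b ∷ w)) ≡ false
allInf-drop-just []      zero    b w _         = refl
allInf-drop-just (x ∷ u) zero    b w _         =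
  trans (cong (isInf x ∧_) (allInf-drop-just u 0 b w z≤n)) (Bool.∧-zeroʳ (isInf x))
allInf-drop-just (x ∷ u) (suc k) b w (s≤s k≤u) = allInf-drop-just u k b w k≤u

drop-++-length : ∀ {A : Set} (u v : List A) k → drop (length u + k) (u ++ v) ≡ drop k v
drop-++-length []      v k = refl
drop-++-length (x ∷ u) v k = drop-++-length u v k

endsWithInfs-short : ∀ ℓ v → length v < ℓ → endsWithInfs ℓ v ≡ false
endsWithInfs-short ℓ v v<ℓ rewrite ≤ᵇ-false v<ℓ = refl

endsWithInfs-++ : ∀ ℓ u v → ℓ ≤ length v → endsWithInfs ℓ (u ++ v) ≡ endsWithInfs ℓ v
endsWithInfs-++ ℓ u v ℓ≤v
  rewrite List.length-++ u {v} | ℕ.+-∸-assoc (length u) ℓ≤v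
        | drop-++-length u v (length v ∸ ℓ) | ≤ᵇ-true ℓ≤v
        | ≤ᵇ-true (ℕ.≤-trans ℓ≤v (ℕ.m≤n+m (length v) (length u))) = refl

endsWithInfs-just : ∀ ℓ u b w → endsWithInfs ℓ (u ++ just b ∷ w) ≡ endsWithInfs ℓ w
endsWithInfs-just ℓ u b w with ℓ ≤? length w
... | yes ℓ≤w = trans (endsWithInfs-++ ℓ u (just b ∷ w) (ℕ.m≤n⇒m≤1+n ℓ≤w))
                      (endsWithInfs-++ ℓ (just b ∷ []) w ℓ≤w)
... | no  ℓ≰w = begin
  (ℓ ≤ᵇ length v) ∧ allInf (drop (length v ∸ ℓ) v)
    ≡⟨ cong ((ℓ ≤ᵇ length v) ∧_) (allInf-drop-just u (length v ∸ ℓ) b w drop-within-u) ⟩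
  (ℓ ≤ᵇ length v) ∧ false
    ≡⟨ Bool.∧-zeroʳ (ℓ ≤ᵇ length v) ⟩
  false
    ≡⟨ sym (endsWithInfs-short ℓ w (ℕ.≰⇒> ℓ≰w)) ⟩
  endsWithInfs ℓ w ∎
  where
  open ≡-Reasoning
  v = u ++ just b ∷ w
  drop-within-u : length v ∸ ℓ ≤ length u
  drop-within-u rewrite List.length-++ u {just b ∷ w} =
    ℕ.≤-trans (ℕ.∸-monoʳ-≤ (length u + suc (length w)) (ℕ.≰⇒> ℓ≰w))
              (ℕ.≤-reflexive (ℕ.m+n∸n≡m (length u) (suc (length w))))

noEarlyBlock-short : ∀ ℓ v → length v ≤ ℓ → noEarlyBlock ℓ v ≡ true
noEarlyBlock-short ℓ []      _   = refl
noEarlyBlock-short ℓ (x ∷ v) v<ℓ rewrite ≤ᵇ-false v<ℓ =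
  noEarlyBlock-short ℓ v (ℕ.<⇒≤ v<ℓ)

noEarlyBlock-just : ∀ ℓ c b w → c < ℓ →
  noEarlyBlock ℓ (replicate c nothing ++ just b ∷ w) ≡ noEarlyBlock ℓ w
noEarlyBlock-just ℓ zero    b w c<ℓ
  rewrite allInf-take-just 0 ℓ b w c<ℓ | Bool.if-eta (ℓ ≤ᵇ length w) {true} = refl
noEarlyBlock-just ℓ (suc c) b w c<ℓ
  rewrite allInf-take-just (suc c) ℓ b w c<ℓ
        | Bool.if-eta (ℓ ≤ᵇ length (replicate c nothing ++ just b ∷ w)) {true}
  = noEarlyBlock-just ℓ c b w (ℕ.<⇒≤ c<ℓ)

noEarlyBlock-overfull : ∀ ℓ x w → 1 ≤ ℓ →
  noEarlyBlock ℓ (replicate ℓ nothing ++ x ∷ w) ≡ false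
noEarlyBlock-overfull (suc ℓ) x w _ =
  cong₂ (λ fits full → (if fits then not full else true) ∧ noEarlyBlock (suc ℓ) v)
        (≤ᵇ-true long-enough) (allInf-take-infs (suc ℓ) (x ∷ w))
  where
  v = replicate ℓ nothing ++ x ∷ w
  long-enough : suc ℓ ≤ length v
  long-enough = subst (suc ℓ ≤_) (sym (trans (length-infs ℓ (x ∷ w)) (ℕ.+-suc ℓ (length w))))
                      (s≤s (ℕ.m≤m+n ℓ (length w)))

finalBlockOnly-infs : ∀ ℓ → finalBlockOnly ℓ (replicate ℓ nothing) ≡ true
finalBlockOnly-infs ℓ = cong₂ _∧_
  (cong₂ _∧_ (≤ᵇ-true (ℕ.≤-reflexive (sym ℓ≡length)))
             (allInf-drop-infs (length (replicate ℓ nothing) ∸ ℓ) ℓ))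
  (noEarlyBlock-short ℓ (replicate ℓ nothing) (ℕ.≤-reflexive ℓ≡length))
  where
  ℓ≡length = List.length-replicate ℓ {nothing}
  allInf-drop-infs : ∀ k n → allInf (drop k (replicate n nothing)) ≡ true
  allInf-drop-infs zero    n       = allInf-replicate n
  allInf-drop-infs (suc k) zero    = refl
  allInf-drop-infs (suc k) (suc n) = allInf-drop-infs k n

finalBlockOnly-short : ∀ ℓ v → length v < ℓ → finalBlockOnly ℓ v ≡ false
finalBlockOnly-short ℓ v v<ℓ = cong (_∧ noEarlyBlock ℓ v) (endsWithInfs-short ℓ v v<ℓ)

finalBlockOnly-overfull : ∀ ℓ x w → 1 ≤ ℓ →
  finalBlockOnly ℓ (replicate ℓ nothing ++ x ∷ w) ≡ false
finalBlockOnly-overfull ℓ x w 1≤ℓ =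
  trans (cong (endsWithInfs ℓ v ∧_) (noEarlyBlock-overfull ℓ x w 1≤ℓ))
        (Bool.∧-zeroʳ (endsWithInfs ℓ v))
  where v = replicate ℓ nothing ++ x ∷ w

finalBlockOnly-just : ∀ ℓ c b w → c < ℓ →
  finalBlockOnly ℓ (replicate c nothing ++ just b ∷ w) ≡ finalBlockOnly ℓ w
finalBlockOnly-just ℓ c b w c<ℓ =
  cong₂ _∧_ (endsWithInfs-just ℓ (replicate c nothing) b w) (noEarlyBlock-just ℓ c b w c<ℓ)

follow-weaken : ∀ {a b} ms e w → a < b → e ≤ length ms →
  follow b ms w ≡ true → follow a (replicate e 1) w ≡ true
follow-weaken ms       zero    w             a<b e≤ms       h = refl
follow-weaken (m ∷ ms) (suc e) []            a<b e≤ms       h = refl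
follow-weaken (m ∷ ms) (suc e) (nothing ∷ w) a<b (s≤s e≤ms) h = follow-weaken ms e w a<b e≤ms h
follow-weaken {a} {b} (m ∷ ms) (suc e) (just y ∷ w) a<b (s≤s e≤ms) h with b + m ≤ᵇ y in b+m≤y
... | true =
  trans (cong (_∧ follow a (replicate e 1) w) (≤ᵇ-true a+1≤y)) (follow-weaken ms e w a<b e≤ms h)
  where
  a+1≤y : a + 1 ≤ y
  a+1≤y = ℕ.≤-trans (ℕ.≤-reflexive (ℕ.+-comm a 1))
            (ℕ.≤-trans a<b (ℕ.≤-trans (ℕ.m≤m+n b m) (≤ᵇ≡true⇒≤ b+m≤y)))
follow-weaken (m ∷ ms) (suc e) (just y ∷ w) a<b (s≤s e≤ms) () | false

follow-d-forces-∞ : ∀ {a b d} ms w → 1 ≤ a → b ≤ d → follow a (d ∷ ms) (just b ∷ w) ≡ false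
follow-d-forces-∞ {a} {b} {d} ms w 1≤a b≤d =
  cong (_∧ follow a ms w) (≤ᵇ-false (ℕ.≤-trans (s≤s b≤d) (ℕ.+-monoˡ-≤ d 1≤a)))

suc+≡⇒< : ∀ k {c n} → suc k + c ≡ n → c < n
suc+≡⇒< k {c} refl = ℕ.m<n+m c (s≤s z≤n)

∧-absorb : ∀ x y z u v → (x ≡ true → z ≡ true → y ≡ true) →
  (x ∧ y) ∧ ((z ∧ u) ∧ v) ≡ x ∧ (z ∧ (u ∧ v))
∧-absorb false y z     u v h = refl
∧-absorb true  y false u v h = Bool.∧-zeroʳ y
∧-absorb true  y true  u v h rewrite h refl refl = refl

module Anchors (d r′ s : ℕ) where
  open Words d

  -- After an integer a, forced a k reads the k ∞'s still required by the constraints μ_j = d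
  -- (a letter b ≤ d cannot exceed a + d), and free a e then allows at most e − 1 further ∞'s
  -- before an integer b > a, or exactly e of them at the end of the word.
  mutual
    forced : ℕ → ℕ → List Letter → Bool
    forced a zero    w             = free a s w
    forced a (suc k) (nothing ∷ w) = forced a k w
    forced a (suc k) _             = false

    free : ℕ → ℕ → List Letter → Bool
    free a zero    []            = true
    free a zero    (_ ∷ _)       = false
    free a (suc e) []            = false
    free a (suc e) (nothing ∷ w) = free a e w
    free a (suc e) (just b ∷ w)  = (a <ᵇ b) ∧ forced b r′ w

  faultFree : List Letter → Bool
  faultFree []            = false
  faultFree (nothing ∷ w) = isSingleInf (nothing ∷ w)
  faultFree (just a ∷ w)  = forced a r′ w

  V : ℕ → Ser
  V b = gf (forced b r′)

  A : ℕ → Ser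
  A a = x· t· Σ-from a d (V ∘ suc)

  x·t·-linear : Linear (x·_ ∘ t·_)
  x·t·-linear = ∘-linear x·-linear t·-linear

  gf-free : ∀ a e → gf (free a e) ≈ x^ e · one ⊕ geom e (A a)
  gf-free a zero    =
    Ser.trans (gf-empty (free a 0) (λ _ _ → refl)) (Ser.sym (Ser.identityʳ one))
  gf-free a (suc e) = begin
    gf (free a (suc e))
      ≈⟨ gf-cons (free a (suc e)) ⟩
    𝟘 ⊕ x· (gf (free a e) ⊕ t· Σ< d (gf ∘ after-a))
      ≈⟨ Ser.identityˡ (x· (gf (free a e) ⊕ t· Σ< d (gf ∘ after-a))) ⟩
    x· (gf (free a e) ⊕ t· Σ< d (gf ∘ after-a))
      ≈⟨ x·-cong (⊕-congˡ (gf (free a e))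
           (t·-cong (Σ<-cong d (λ x → gf-∧ (a <ᵇ suc x) (forced (suc x) r′))))) ⟩
    x· (gf (free a e) ⊕ t· Σ-from a d (V ∘ suc))
      ≈⟨ x·-⊕ (gf (free a e)) (t· Σ-from a d (V ∘ suc)) ⟩
    x· gf (free a e) ⊕ A a
      ≈⟨ ⊕-congʳ (A a) (x·-cong (gf-free a e)) ⟩
    x· (x^ e · one ⊕ geom e (A a)) ⊕ A a
      ≈⟨ ⊕-congʳ (A a) (x·-⊕ (x^ e · one) (geom e (A a))) ⟩
    (x^ suc e · one ⊕ x· geom e (A a)) ⊕ A a
      ≈⟨ Ser.assoc (x^ suc e · one) (x· geom e (A a)) (A a) ⟩
    x^ suc e · one ⊕ (x· geom e (A a) ⊕ A a)
      ≈⟨ ⊕-congˡ (x^ suc e · one)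
           (Ser.trans (Ser.comm (x· geom e (A a)) (A a)) (Ser.sym (geom-suc e (A a)))) ⟩
    x^ suc e · one ⊕ geom (suc e) (A a) ∎
    where
    open ≈-Reasoning
    after-a = λ x w → (a <ᵇ suc x) ∧ forced (suc x) r′ w

  gf-forced : ∀ a k → gf (forced a k) ≈ x^ k · gf (free a s)
  gf-forced a zero    = ≈-refl
  gf-forced a (suc k) = begin
    gf (forced a (suc k))
      ≈⟨ gf-cons (forced a (suc k)) ⟩
    𝟘 ⊕ x· (gf (forced a k) ⊕ t· Σ< d (λ _ → gf (λ _ → false)))
      ≈⟨ Ser.identityˡ (x· (gf (forced a k) ⊕ t· Σ< d (λ _ → gf (λ _ → false)))) ⟩
    x· (gf (forced a k) ⊕ t· Σ< d (λ _ → gf (λ _ → false)))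
      ≈⟨ x·-cong (⊕-congˡ (gf (forced a k)) (t·Σ<-gf-vanish (λ _ _ → false) (λ _ _ → refl))) ⟩
    x· (gf (forced a k) ⊕ 𝟘)
      ≈⟨ x·-cong (Ser.identityʳ (gf (forced a k))) ⟩
    x· gf (forced a k)
      ≈⟨ x·-cong (gf-forced a k) ⟩
    x^ suc k · gf (free a s) ∎
    where open ≈-Reasoning

  gf-faultFree : gf faultFree ≈ x· one ⊕ A 0
  gf-faultFree = begin
    gf faultFree
      ≈⟨ gf-cons faultFree ⟩
    𝟘 ⊕ x· (gf single ⊕ t· Σ< d (V ∘ suc))
      ≈⟨ Ser.identityˡ (x· (gf single ⊕ t· Σ< d (V ∘ suc))) ⟩
    x· (gf single ⊕ t· Σ< d (V ∘ suc))
      ≈⟨ x·-cong (⊕-congʳ (t· Σ< d (V ∘ suc)) (gf-empty single (λ _ _ → refl))) ⟩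
    x· (one ⊕ t· Σ< d (V ∘ suc))
      ≈⟨ x·-⊕ one (t· Σ< d (V ∘ suc)) ⟩
    x· one ⊕ A 0 ∎
    where
    open ≈-Reasoning
    single = λ w → isSingleInf (nothing ∷ w)

  A-top : A d ≈ 𝟘
  A-top = Ser.trans (Linear.cong≈ x·t·-linear (Σ-from-empty (V ∘ suc) (ℕ.≤-refl {d})))
                    (Linear.𝟘-homo x·t·-linear)

  A-step : ∀ a → a < d → A a ≈ A (suc a) ⊕ x^ suc r′ · t· (x^ s · one ⊕ geom s (A (suc a)))
  A-step a a<d = begin
    A a
      ≈⟨ Linear.cong≈ x·t·-linear (Σ-from-first (V ∘ suc) a<d) ⟩
    x· t· (V (suc a) ⊕ Σ-from (suc a) d (V ∘ suc))
      ≈⟨ Linear.⊕-homo x·t·-linear (V (suc a)) (Σ-from (suc a) d (V ∘ suc)) ⟩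
    x· t· V (suc a) ⊕ A (suc a)
      ≈⟨ Ser.comm (x· t· V (suc a)) (A (suc a)) ⟩
    A (suc a) ⊕ x· t· V (suc a)
      ≈⟨ ⊕-congˡ (A (suc a)) (Linear.cong≈ x·t·-linear
           (Ser.trans (gf-forced (suc a) r′) (x^-cong r′ (gf-free (suc a) s)))) ⟩
    A (suc a) ⊕ x· t· x^ r′ · W
      ≈⟨ ⊕-congˡ (A (suc a)) (x·-cong (x^-comm t·-linear r′ W)) ⟩
    A (suc a) ⊕ x^ suc r′ · t· W ∎
    where
    open ≈-Reasoning
    W = x^ s · one ⊕ geom s (A (suc a))

module Characterisation (d r′ s : ℕ) (1≤s : 1 ≤ s) where
  open Words d
  open Anchors d r′ s

  μ : List ℕ
  μ = muDRS d (suc r′) s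

  tl : List ℕ
  tl = tailμ μ

  ℓ : ℕ
  ℓ = ellOf μ

  ℓ≡r′+s : ℓ ≡ r′ + s
  ℓ≡r′+s = trans (List.length-++ (replicate r′ d))
                 (cong₂ _+_ (List.length-replicate r′) (List.length-replicate s))

  1≤ℓ : 1 ≤ ℓ
  1≤ℓ = subst (1 ≤_) (sym ℓ≡r′+s) (ℕ.≤-trans 1≤s (ℕ.m≤n+m s r′))

  -- The suffix `just a ∷ replicate c nothing ++ w` of a word is valid: a's constraints still
  -- pending on w are ms, the later integers satisfy theirs, and the only block of ℓ ∞'s is final.
  tailOK : ℕ → List ℕ → ℕ → List Letter → Bool
  tailOK a ms c w = follow a ms w ∧ constraints tl w ∧ finalBlockOnly ℓ (replicate c nothing ++ w)

  tailOK-∞ : ∀ a m ms c w → tailOK a (m ∷ ms) c (nothing ∷ w) ≡ tailOK a ms (suc c) w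
  tailOK-∞ a m ms c w =
    cong (λ v → follow a ms w ∧ constraints tl w ∧ finalBlockOnly ℓ v) (infs-snoc c w)

  tailOK-blocked : ∀ a ms c w →
    finalBlockOnly ℓ (replicate c nothing ++ w) ≡ false → tailOK a ms c w ≡ false
  tailOK-blocked a ms c w blocked =
    trans (cong (λ z → follow a ms w ∧ constraints tl w ∧ z) blocked)
          (trans (cong (follow a ms w ∧_) (Bool.∧-zeroʳ (constraints tl w)))
                 (Bool.∧-zeroʳ (follow a ms w)))

  tailOK-short : ∀ a ms c → c < ℓ → tailOK a ms c [] ≡ false
  tailOK-short a ms c c<ℓ = tailOK-blocked a ms c [] (finalBlockOnly-short ℓ _
    (subst (_< ℓ) (sym (trans (length-infs c []) (ℕ.+-identityʳ c))) c<ℓ))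

  mutual
    forced-correct : ∀ {a} k c {w} → 1 ≤ a → All InRange w → k + c ≡ r′ →
      forced a k w ≡ tailOK a (replicate k d ++ replicate s 1) c w
    forced-correct zero c 1≤a ok c≡r′ = free-correct s c 1≤a ok
      (trans (cong (_+_ s) c≡r′) (trans (ℕ.+-comm s r′) (sym ℓ≡r′+s)))
    forced-correct {a} (suc k) c {[]} 1≤a ok k+c≡r′ =
      sym (tailOK-short a (replicate (suc k) d ++ replicate s 1) c
            (ℕ.<-≤-trans (suc+≡⇒< k k+c≡r′) (subst (r′ ≤_) (sym ℓ≡r′+s) (ℕ.m≤m+n r′ s))))
    forced-correct {a} (suc k) c {nothing ∷ w} 1≤a (_ ∷ ok) k+c≡r′ =
      trans (forced-correct k (suc c) 1≤a ok (trans (ℕ.+-suc k c) k+c≡r′))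
            (sym (tailOK-∞ a d (replicate k d ++ replicate s 1) c w))
    forced-correct {a} (suc k) c {just b ∷ w} 1≤a ((_ , b≤d) ∷ _) _ =
      sym (cong (_∧ constraints tl (just b ∷ w) ∧ finalBlockOnly ℓ (replicate c nothing ++ just b ∷ w))
                (follow-d-forces-∞ (replicate k d ++ replicate s 1) w 1≤a b≤d))

    free-correct : ∀ {a} e c {w} → 1 ≤ a → All InRange w → e + c ≡ ℓ →
      free a e w ≡ tailOK a (replicate e 1) c w
    free-correct zero .ℓ {[]} 1≤a ok refl = sym (begin
      finalBlockOnly ℓ (replicate ℓ nothing ++ [])
        ≡⟨ cong (finalBlockOnly ℓ) (List.++-identityʳ (replicate ℓ nothing)) ⟩
      finalBlockOnly ℓ (replicate ℓ nothing)
        ≡⟨ finalBlockOnly-infs ℓ ⟩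
      true ∎)
      where open ≡-Reasoning
    free-correct {a} zero .ℓ {x ∷ w} 1≤a ok refl =
      sym (tailOK-blocked a [] ℓ (x ∷ w) (finalBlockOnly-overfull ℓ x w 1≤ℓ))
    free-correct {a} (suc e) c {[]} 1≤a ok e+c≡ℓ =
      sym (tailOK-short a (replicate (suc e) 1) c (suc+≡⇒< e e+c≡ℓ))
    free-correct {a} (suc e) c {nothing ∷ w} 1≤a (_ ∷ ok) e+c≡ℓ =
      trans (free-correct e (suc c) 1≤a ok (trans (ℕ.+-suc e c) e+c≡ℓ))
            (sym (tailOK-∞ a 1 (replicate e 1) c w))
    free-correct {a} (suc e) c {just b ∷ w} 1≤a ((1≤b , _) ∷ ok) e+c≡ℓ = begin
      (a <ᵇ b) ∧ forced b r′ w
        ≡⟨ cong ((a <ᵇ b) ∧_) (forced-correct r′ 0 1≤b ok (ℕ.+-identityʳ r′)) ⟩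
      (a <ᵇ b) ∧ (F ∧ C ∧ finalBlockOnly ℓ w)
        ≡⟨ sym (∧-absorb (a <ᵇ b) (follow a (replicate e 1) w) F C (finalBlockOnly ℓ w)
                         a-follows) ⟩
      ((a <ᵇ b) ∧ follow a (replicate e 1) w) ∧ ((F ∧ C) ∧ finalBlockOnly ℓ w)
        ≡⟨ cong₂ (λ x y → (x ∧ follow a (replicate e 1) w) ∧ ((F ∧ C) ∧ y))
                 (cong (_≤ᵇ b) (ℕ.+-comm 1 a))
                 (sym (finalBlockOnly-just ℓ c b w (suc+≡⇒< e e+c≡ℓ))) ⟩
      tailOK a (replicate (suc e) 1) c (just b ∷ w) ∎
      where
      open ≡-Reasoning
      F = follow b tl w
      C = constraints tl w
      e≤ℓ : e ≤ length tl
      e≤ℓ = ℕ.≤-trans (ℕ.n≤1+n e) (ℕ.≤-trans (ℕ.m≤m+n (suc e) c) (ℕ.≤-reflexive e+c≡ℓ))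
      a-follows : (a <ᵇ b) ≡ true → F ≡ true → follow a (replicate e 1) w ≡ true
      a-follows a<b = follow-weaken tl e w (ℕ.<ᵇ⇒< a b (subst T (sym a<b) tt)) e≤ℓ

  faultFree-correct : ∀ {w} → All InRange w → isFaultFree μ w ≡ faultFree w
  faultFree-correct {[]}          _ = Bool.∧-zeroʳ (isAnchor μ [])
  faultFree-correct {nothing ∷ w} _ =
    trans (cong (isSingleInf (nothing ∷ w) ∨_) (Bool.∧-zeroʳ (isAnchor μ (nothing ∷ w))))
          (Bool.∨-identityʳ (isSingleInf (nothing ∷ w)))
  faultFree-correct {just a ∷ w} ((1≤a , _) ∷ ok) = begin
    ((F ∧ C) ∧ endsWithInfs ℓ (just a ∷ w)) ∧ noEarlyBlock ℓ (just a ∷ w)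
      ≡⟨ trans (Bool.∧-assoc (F ∧ C) _ _) (Bool.∧-assoc F C _) ⟩
    F ∧ C ∧ finalBlockOnly ℓ (just a ∷ w)
      ≡⟨ cong (λ z → F ∧ C ∧ z) (finalBlockOnly-just ℓ 0 a w 1≤ℓ) ⟩
    F ∧ C ∧ finalBlockOnly ℓ w
      ≡⟨ sym (forced-correct r′ 0 1≤a ok (ℕ.+-identityʳ r′)) ⟩
    forced a r′ w ∎
    where
    open ≡-Reasoning
    F = follow a tl w
    C = constraints tl w

  B-decomposition : B μ d ≈ x· one ⊕ A 0
  B-decomposition = Ser.trans (gf-cong faultFree-correct) gf-faultFree

theorem4p29 : (d r s : ℕ) → d ≥ 1 → r ≥ 1 → s ≥ 1 →
    (i j : ℕ) →
    (geomS s ⊛ B (muDRS d r s) d) i j ≡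
    ((geomS s ⊛ mono 1 0)
      ⊕ (mono s 0 ⊛ (((one ⊕ (mono r 1 ⊛ geomS s)) ^S d) ⊖ one))) i j
theorem4p29 d (suc r′) s _ (s≤s z≤n) s≥1 =
  closed-form A d A-top A-step B-decomposition
  where
  open Anchors d r′ s
  open Characterisation d r′ s s≥1
  open Recurrence (suc r′) s
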